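{- Let $G$ be an abelian group, let $q\in\mathbb N$, let $\mathcal A=(A_1,\dots,A_q)$ be a $q$-tuple of nonempty subsets of $G$, and fix $r\in\mathbb N$. Assume that for each $i\in\{1,\dots,q\}$ the set $A_i$ is an asymptotic $(r,\ell_i)$-approximate group, where $\ell_i\in\mathbb N$. Then $\mathcal A$ is a chromatic asymptotic $\bigl(r,\prod_{i=1}^q \ell_i\bigr)$-approximate group.
   Context: $\mathbb N=\{1,2,\dots\}$, $\mathbb N_0=\{0,1,2,\dots\}$. For subsets $X,Y$ of an abelian group, $X+Y=\{x+y:x\in X,y\in Y\}$; for $h\in\mathbb N$, $hA=A+\cdots+A$ ($h$ summands) and $0A=\{0\}$. A nonempty set $A\subseteq G$ is an asymptotic $(r,\ell)$-approximate group if there is $h_0\in\mathbb N$ such that for every integer $h\ge h_0$ there is $X_h\subseteq G$ with $|X_h|\le\ell$ and $r(hA)\subseteq X_h+hA$. For $\mathbf h=(h_1,\dots,h_q)\in\mathbb N_0^q$ the chromatic sumset is $\mathbf h\cdot\mathcal A=h_1A_1+\cdots+h_qA_q$; $r\mathbf h=(rh_1,\dots,rh_q)$; $\mathbf h\preceq\mathbf h'$ means $h_i\le h_i'$ for all $i$. A tuple $\mathcal A$ of nonempty subsets of $G$ is a chromatic asymptotic $(r,\ell)$-approximate group if there is $\mathbf h_0\in\mathbb N_0^q$ such that for every $\mathbf h\succeq\mathbf h_0$ there is $X_{\mathbf h}\subseteq G$ with $|X_{\mathbf h}|\le\ell$ and $(r\mathbf h)\cdot\mathcal A\subseteq X_{\mathbf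 h}+\mathbf h\cdot\mathcal A$. -}

module Defs where

open import Level using (Level; _⊔_)
open import Algebra.Bundles using (AbelianGroup)
open import Data.Nat using (ℕ; zero; suc; _*_; _≤_)
open import Data.Fin using (Fin; zero; suc)
open import Data.List using (List; length)
open import Data.List.Membership.Propositional using (_∈_)
open import Data.Product using (Σ; ∃; ∃-syntax; _×_; _,_)

prodFin : {q : ℕ} → (Fin q → ℕ) → ℕ
prodFin {zero} ℓ = 1
prodFin {suc q} ℓ = ℓ zero * prodFin (λ i → ℓ (suc i))

module Sumsets {c e : Level} (G : AbelianGroup c e) where
  open AbelianGroup G

  Subset : (a : Level) → Set (c ⊔ Level.suc a)
  Subset a = Carrier → Set a

  _⊆_ : {a b : Level} → Subset a → Subset b → Set (c ⊔ a ⊔ b)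
  X ⊆ Y = ∀ x → X x → Y x

  Nonempty : {a : Level} → Subset a → Set (c ⊔ a)
  Nonempty A = ∃[ x ] A x

  zeroSet : Subset e
  zeroSet x = x ≈ ε

  _⊕_ : {a b : Level} → Subset a → Subset b → Subset (c ⊔ e ⊔ a ⊔ b)
  (X ⊕ Y) z = ∃[ x ] ∃[ y ] (X x × Y y × z ≈ x ∙ y)

  _·_ : {a : Level} → ℕ → Subset a → Subset (c ⊔ e ⊔ a)
  _·_ {a} zero A = λ x → Level.Lift (c ⊔ a) (x ≈ ε)
  _·_ {a} (suc h) A = λ z → ∃[ x ] ∃[ y ] (A x × (h · A) y × z ≈ x ∙ y)

  _⊕ᴸ_ : {a : Level} → List Carrier → Subset a → Subset (c ⊔ e ⊔ a)
  (X ⊕ᴸ S) z = ∃[ x ] ∃[ s ] (x ∈ X × S s × z ≈ x ∙ s)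

  -- chromatic sumset h·𝒜 = h₁A₁ + ... + h_qA_q
  chrom : {a : Level} {q : ℕ} → (Fin q → ℕ) → (Fin q → Subset a) → Subset (c ⊔ e ⊔ a)
  chrom {a = a} {q = zero} h 𝒜 = λ x → Level.Lift (c ⊔ a) (x ≈ ε)
  chrom {q = suc q} h 𝒜 = λ z → ∃[ x ] ∃[ y ]
    ((h zero · 𝒜 zero) x × chrom (λ i → h (suc i)) (λ i → 𝒜 (suc i)) y × z ≈ x ∙ y)

  AsymptoticApproxGroup : {a : Level} → ℕ → ℕ → Subset a → Set (c ⊔ e ⊔ a)
  AsymptoticApproxGroup {a} r ℓ A =
    ∃[ h₀ ] ((h : ℕ) → h₀ ≤ h →
      Σ (List Carrier) λ X → (length X ≤ ℓ × ((_·_ {c ⊔ e ⊔ a} r (h · A)) ⊆ (X ⊕ᴸ (h · A)))))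

  ChromaticAsymptoticApproxGroup : {a : Level} {q : ℕ} → ℕ → ℕ → (Fin q → Subset a) → Set (c ⊔ e ⊔ a)
  ChromaticAsymptoticApproxGroup {a} {q} r ℓ 𝒜 =
    Σ (Fin q → ℕ) λ h₀ → ((h : Fin q → ℕ) → (∀ i → h₀ i ≤ h i) →
      Σ (List Carrier) λ X → (length X ≤ ℓ × (chrom {a} (λ i → r * h i) 𝒜 ⊆ (X ⊕ᴸ chrom {a} h 𝒜))))

{-# OPTIONS --safe #-}
module Submission where

-- Since (rh)A ⊆ r(hA), each colour class satisfies (r hᵢ)Aᵢ ⊆ Xᵢ + hᵢAᵢ once hᵢ is past the
-- threshold of Aᵢ. Adding these q inclusions and regrouping the sums (G is abelian) gives
-- (r𝐡)·𝒜 ⊆ (X₁ + ⋯ + X_q) + 𝐡·𝒜, and X₁ + ⋯ + X_q is listed by at most ℓ₁ ⋯ ℓ_q elements.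

open import Defs
open import Level using (Level; _⊔_; lift)
open import Algebra.Bundles using (AbelianGroup)
open import Data.Nat using (ℕ; _≤_; zero; suc; _+_; _*_)
open import Data.Nat.Properties using (*-mono-≤; ≤-refl)
open import Data.Fin using (Fin; zero; suc)
open import Data.List using (List; []; _∷_; [_]; length; map; _++_; cartesianProductWith)
open import Data.List.Properties using (length-++; length-map)
open import Data.List.Membership.Propositional.Properties using (∈-cartesianProductWith⁺)
open import Data.List.Relation.Unary.Any using (here)
open import Data.Product using (Σ; _×_; _,_; proj₁; proj₂)
open import Relation.Binary.PropositionalEquality as ≡ using (_≡_; cong₂; subst)
import Algebra.Properties.CommutativeSemigroup as CommutativeSemigroupProperties

length-cartesianProductWith : ∀ {a b c} {A : Set a} {B : Set b} {C : Set c}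
  (f : A → B → C) (xs : List A) (ys : List B) →
  length (cartesianProductWith f xs ys) ≡ length xs * length ys
length-cartesianProductWith f [] ys = ≡.refl
length-cartesianProductWith f (x ∷ xs) ys = begin
  length (map (f x) ys ++ cartesianProductWith f xs ys)
    ≡⟨ length-++ (map (f x) ys) ⟩
  length (map (f x) ys) + length (cartesianProductWith f xs ys)
    ≡⟨ cong₂ _+_ (length-map (f x) ys) (length-cartesianProductWith f xs ys) ⟩
  length ys + length xs * length ys
    ∎
  where
  open ≡.≡-Reasoning

module _ {c e : Level} (G : AbelianGroup c e) where
  open AbelianGroup G
  open Sumsets G
  open CommutativeSemigroupProperties commutativeSemigroup using (interchange)

  ⊆-trans : ∀ {a b d} {X : Subset a} {Y : Subset b} {Z : Subset d} → X ⊆ Y → Y ⊆ Z → X ⊆ Z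
  ⊆-trans X⊆Y Y⊆Z z z∈X = Y⊆Z z (X⊆Y z z∈X)

  ·-+-⊆ : ∀ {a} (A : Subset a) (m n : ℕ) → ((m + n) · A) ⊆ ((m · A) ⊕ (n · A))
  ·-+-⊆ A zero n z z∈nA = ε , z , lift refl , z∈nA , sym (identityˡ z)
  ·-+-⊆ A (suc m) n z (u , w , u∈A , w∈[m+n]A , z≈u∙w)
    with ·-+-⊆ A m n w w∈[m+n]A
  ... | x , y , x∈mA , y∈nA , w≈x∙y =
    u ∙ x , y , (u , x , u∈A , x∈mA , refl) , y∈nA ,
    trans z≈u∙w (trans (∙-congˡ w≈x∙y) (sym (assoc u x y)))

  ·-*-⊆ : ∀ {a} (A : Subset a) (r h : ℕ) → ((r * h) · A) ⊆ (r · (h · A))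
  ·-*-⊆ A zero h z (lift z≈ε) = lift z≈ε
  ·-*-⊆ A (suc r) h z z∈[h+rh]A with ·-+-⊆ A h (r * h) z z∈[h+rh]A
  ... | x , y , x∈hA , y∈rhA , z≈x∙y = x , y , x∈hA , ·-*-⊆ A r h y y∈rhA , z≈x∙y

  ⊕ᴸ-⊕-⊆ : ∀ {a b} (X Y : List Carrier) (S : Subset a) (T : Subset b) →
    ((X ⊕ᴸ S) ⊕ (Y ⊕ᴸ T)) ⊆ (cartesianProductWith _∙_ X Y ⊕ᴸ (S ⊕ T))
  ⊕ᴸ-⊕-⊆ X Y S T z (u , v , (x , s , x∈X , s∈S , u≈x∙s) , (y , t , y∈Y , t∈T , v≈y∙t) , z≈u∙v) =
    x ∙ y , s ∙ t , ∈-cartesianProductWith⁺ _∙_ x∈X y∈Y , (s , t , s∈S , t∈T , refl) ,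
    trans z≈u∙v (trans (∙-cong u≈x∙s v≈y∙t) (interchange x s y t))

  ⊕-mono : ∀ {a b a′ b′} {S : Subset a} {T : Subset b} {S′ : Subset a′} {T′ : Subset b′} →
    S ⊆ S′ → T ⊆ T′ → (S ⊕ T) ⊆ (S′ ⊕ T′)
  ⊕-mono S⊆S′ T⊆T′ z (s , t , s∈S , t∈T , z≈s∙t) = s , t , S⊆S′ s s∈S , T⊆T′ t t∈T , z≈s∙t

  Covering : ∀ {a b} → ℕ → Subset a → Subset b → Set (c ⊔ e ⊔ a ⊔ b)
  Covering ℓ S T = Σ (List Carrier) λ X → length X ≤ ℓ × S ⊆ (X ⊕ᴸ T)

  chrom-covering : ∀ {a} {q : ℕ} (𝒜 : Fin q → Subset a) (h′ h ℓ : Fin q → ℕ) →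
    (∀ i → Covering (ℓ i) (h′ i · 𝒜 i) (h i · 𝒜 i)) →
    Covering (prodFin ℓ) (chrom h′ 𝒜) (chrom h 𝒜)
  chrom-covering {q = zero} 𝒜 h′ h ℓ covers =
    [ ε ] , ≤-refl , λ { z (lift z≈ε) → ε , ε , here ≡.refl , lift refl , trans z≈ε (sym (identityˡ ε)) }
  chrom-covering {q = suc q} 𝒜 h′ h ℓ covers
    with covers zero
       | chrom-covering (λ i → 𝒜 (suc i)) (λ i → h′ (suc i)) (λ i → h (suc i)) (λ i → ℓ (suc i))
                        (λ i → covers (suc i))
  ... | X , |X|≤ℓ₀ , cover₀ | Y , |Y|≤ℓ₊ , cover₊ =
    cartesianProductWith _∙_ X Y ,
    subst (_≤ prodFin ℓ) (≡.sym (length-cartesianProductWith _∙_ X Y)) (*-mono-≤ |X|≤ℓ₀ |Y|≤ℓ₊) ,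
    ⊆-trans (⊕-mono cover₀ cover₊) (⊕ᴸ-⊕-⊆ X Y _ _)

theorem1p11 : {c e a : Level} (G : AbelianGroup c e) (q : ℕ) → 1 ≤ q →
    (𝒜 : Fin q → Sumsets.Subset G a) → (∀ i → Sumsets.Nonempty G (𝒜 i)) →
    (r : ℕ) → 1 ≤ r → (ℓ : Fin q → ℕ) → (∀ i → 1 ≤ ℓ i) →
    (∀ i → Sumsets.AsymptoticApproxGroup G r (ℓ i) (𝒜 i)) →
    Sumsets.ChromaticAsymptoticApproxGroup G r (prodFin ℓ) 𝒜
theorem1p11 G q _ 𝒜 _ r _ ℓ _ approx =
  (λ i → proj₁ (approx i)) ,
  λ h h₀≤h → chrom-covering G 𝒜 (λ i → r * h i) h ℓ (λ i → colourCovering i (h i) (h₀≤h i))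
  where
  open Sumsets G
  colourCovering : ∀ i h → proj₁ (approx i) ≤ h → Covering G (ℓ i) ((r * h) · 𝒜 i) (h · 𝒜 i)
  colourCovering i h h₀≤h with proj₂ (approx i) h h₀≤h
  ... | X , |X|≤ℓ , r[hA]⊆X+hA = X , |X|≤ℓ , ⊆-trans G (·-*-⊆ G (𝒜 i) r h) r[hA]⊆X+hA
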